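{- Let $(T,\mu,\eta)$ be a monad on $\mathsf{C}$ such that: $\mathcal{K}l(T)$ is $\omega$-cpo enriched; every hom-set of $\mathcal{K}l(T)$ has finite joins; and for every $\alpha:X\rightsquigarrow X$, every $f:X\to Y$ in $\mathsf{C}$ and every $\beta:Y\rightsquigarrow Y$, $f^\sharp\cdot\alpha\le\beta\cdot f^\sharp$ implies $f^\sharp\cdot(\alpha\vee 1_X)\le(\beta\vee 1_Y)\cdot f^\sharp$, and $f^\sharp\cdot\alpha\ge\beta\cdot f^\sharp$ implies $f^\sharp\cdot(\alpha\vee 1_X)\ge(\beta\vee 1_Y)\cdot f^\sharp$. Then $T$ is an ordered saturation monad, with $\alpha^*=\bigvee_{n\in\mathbb{N}}(1_X\vee\alpha)^n$ for every $\alpha:X\rightsquigarrow X$.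
   Context: Kleisli category $\mathcal{K}l(T)$: morphisms $X\rightsquigarrow Y$ are morphisms $X\to TY$, composition $g\cdot f=\mu_Z\circ Tg\circ f$, identity $1_X=\eta_X$; $f^\sharp=\eta_Y\circ f$; powers $\alpha^n$ are taken w.r.t. $\cdot$. A category is $\omega$-cpo enriched if each hom-set is a poset (composition monotone) in which every ascending chain $f_1\le f_2\le\cdots$ has a supremum, and composition preserves these suprema. Ordered saturation monad: $\mathcal{K}l(T)$ order enriched and for each $\alpha:X\rightsquigarrow X$ there is $\alpha^*$ with (1) $1\le\alpha^*$; (2) $\alpha\le\alpha^*$; (3) $\alpha^*\cdot\alpha^*\le\alpha^*$; (4) $\alpha^*\le\beta$ whenever $1\le\beta$, $\alpha\le\beta$, $\beta\cdot\beta\le\beta$; (5) for $f:X\to Y$ in $\mathsf{C}$ and $\beta:Y\rightsquigarrow Y$, $f^\sharp\cdot\alpha\le\beta\cdot f^\sharp\Rightarrow f^\sharp\cdot\alpha^*\le\beta^*\cdot f^\sharp$, and likewise with $\ge$. -}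

module Defs where

open import Level using (Level; _⊔_) renaming (suc to lsuc)
open import Data.Nat using (ℕ; zero; suc)
open import Data.Product using (_×_; _,_)
open import Relation.Binary.PropositionalEquality using (_≡_)

record Category (o h : Level) : Set (lsuc (o ⊔ h)) where
  infixr 9 _∘_
  field
    Obj  : Set o
    Hom  : Obj → Obj → Set h
    id   : ∀ {X} → Hom X X
    _∘_  : ∀ {X Y Z} → Hom Y Z → Hom X Y → Hom X Z
    identityˡ : ∀ {X Y} (f : Hom X Y) → id ∘ f ≡ f
    identityʳ : ∀ {X Y} (f : Hom X Y) → f ∘ id ≡ f
    assoc     : ∀ {W X Y Z} (h : Hom Y Z) (g : Hom X Y) (f : Hom W X) →
                (h ∘ g) ∘ f ≡ h ∘ (g ∘ f)

record Monad {o h : Level} (C : Category o h) : Set (o ⊔ h) where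
  open Category C
  field
    T₀   : Obj → Obj
    T₁   : ∀ {X Y} → Hom X Y → Hom (T₀ X) (T₀ Y)
    T-id : ∀ {X} → T₁ (id {X}) ≡ id
    T-∘  : ∀ {X Y Z} (g : Hom Y Z) (f : Hom X Y) → T₁ (g ∘ f) ≡ T₁ g ∘ T₁ f
    η    : ∀ X → Hom X (T₀ X)
    μ    : ∀ X → Hom (T₀ (T₀ X)) (T₀ X)
    η-natural : ∀ {X Y} (f : Hom X Y) → T₁ f ∘ η X ≡ η Y ∘ f
    μ-natural : ∀ {X Y} (f : Hom X Y) → T₁ f ∘ μ X ≡ μ Y ∘ T₁ (T₁ f)
    μ-assoc   : ∀ X → μ X ∘ T₁ (μ X) ≡ μ X ∘ μ (T₀ X)
    μ-unitˡ   : ∀ X → μ X ∘ η (T₀ X) ≡ id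
    μ-unitʳ   : ∀ X → μ X ∘ T₁ (η X) ≡ id

module Kleisli {o h : Level} {C : Category o h} (M : Monad C) where
  open Category C
  open Monad M

  KHom : Obj → Obj → Set h
  KHom X Y = Hom X (T₀ Y)

  infixr 9 _·_
  _·_ : ∀ {X Y Z} → KHom Y Z → KHom X Y → KHom X Z
  _·_ {Z = Z} g f = μ Z ∘ (T₁ g ∘ f)

  kid : ∀ {X} → KHom X X
  kid {X} = η X

  _♯ : ∀ {X Y} → Hom X Y → KHom X Y
  _♯ {Y = Y} f = η Y ∘ f

  _^_ : ∀ {X} → KHom X X → ℕ → KHom X X
  α ^ zero  = kid
  α ^ suc n = α · (α ^ n)

record KlOrder {o h : Level} {C : Category o h} (M : Monad C) (ℓ : Level)
       : Set (o ⊔ h ⊔ lsuc ℓ) where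
  open Category C using (Obj)
  open Kleisli M
  infix 4 _≤_
  field
    _≤_     : ∀ {X Y} → KHom X Y → KHom X Y → Set ℓ
    ≤-refl  : ∀ {X Y} {f : KHom X Y} → f ≤ f
    ≤-trans : ∀ {X Y} {f g k : KHom X Y} → f ≤ g → g ≤ k → f ≤ k
    ≤-antisym : ∀ {X Y} {f g : KHom X Y} → f ≤ g → g ≤ f → f ≡ g
    ·-mono  : ∀ {X Y Z} {f f' : KHom X Y} {g g' : KHom Y Z} →
              f ≤ f' → g ≤ g' → g · f ≤ g' · f'

  IsSup : ∀ {X Y} → (ℕ → KHom X Y) → KHom X Y → Set (h ⊔ ℓ)
  IsSup {X} {Y} c s = (∀ n → c n ≤ s) × (∀ (u : KHom X Y) → (∀ n → c n ≤ u) → s ≤ u)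

  Ascending : ∀ {X Y} → (ℕ → KHom X Y) → Set ℓ
  Ascending c = ∀ n → c n ≤ c (suc n)

record OmegaCpoEnriched {o h ℓ : Level} {C : Category o h} {M : Monad C}
       (O : KlOrder M ℓ) : Set (o ⊔ h ⊔ ℓ) where
  open Kleisli M
  open KlOrder O
  field
    sup      : ∀ {X Y} (c : ℕ → KHom X Y) → Ascending c → KHom X Y
    sup-isSup : ∀ {X Y} (c : ℕ → KHom X Y) (a : Ascending c) → IsSup c (sup c a)
    ·-sup-right : ∀ {X Y Z} (g : KHom Y Z) (c : ℕ → KHom X Y) (a : Ascending c) →
                  IsSup (λ n → g · c n) (g · sup c a)
    ·-sup-left  : ∀ {X Y Z} (c : ℕ → KHom Y Z) (a : Ascending c) (f : KHom X Y) →
                  IsSup (λ n → c n · f) (sup c a · f)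

record FiniteJoins {o h ℓ : Level} {C : Category o h} {M : Monad C}
       (O : KlOrder M ℓ) : Set (o ⊔ h ⊔ ℓ) where
  open Kleisli M
  open KlOrder O
  infixr 6 _∨_
  field
    _∨_  : ∀ {X Y} → KHom X Y → KHom X Y → KHom X Y
    ⊥    : ∀ {X Y} → KHom X Y
    ∨-upperˡ : ∀ {X Y} (f g : KHom X Y) → f ≤ f ∨ g
    ∨-upperʳ : ∀ {X Y} (f g : KHom X Y) → g ≤ f ∨ g
    ∨-least  : ∀ {X Y} {f g k : KHom X Y} → f ≤ k → g ≤ k → f ∨ g ≤ k
    ⊥-least  : ∀ {X Y} (f : KHom X Y) → ⊥ ≤ f

JoinCompatible : {o h ℓ : Level} {C : Category o h} {M : Monad C}
                 (O : KlOrder M ℓ) → FiniteJoins O → Set (o ⊔ h ⊔ ℓ)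
JoinCompatible {C = C} {M = M} O J =
  ∀ {X Y} (α : KHom X X) (f : Hom X Y) (β : KHom Y Y) →
    ((f ♯) · α ≤ β · (f ♯) → (f ♯) · (α ∨ kid) ≤ (β ∨ kid) · (f ♯)) ×
    (β · (f ♯) ≤ (f ♯) · α → (β ∨ kid) · (f ♯) ≤ (f ♯) · (α ∨ kid))
  where
    open Category C
    open Kleisli M
    open KlOrder O
    open FiniteJoins J

record OrderedSaturation {o h ℓ : Level} {C : Category o h} {M : Monad C}
       (O : KlOrder M ℓ) : Set (o ⊔ h ⊔ ℓ) where
  open Category C using (Hom)
  open Kleisli M
  open KlOrder O
  field
    _* : ∀ {X} → KHom X X → KHom X X
    sat-1 : ∀ {X} (α : KHom X X) → kid ≤ α *
    sat-2 : ∀ {X} (α : KHom X X) → α ≤ α *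
    sat-3 : ∀ {X} (α : KHom X X) → (α *) · (α *) ≤ α *
    sat-4 : ∀ {X} (α β : KHom X X) → kid ≤ β → α ≤ β → β · β ≤ β → α * ≤ β
    sat-5≤ : ∀ {X Y} (α : KHom X X) (f : Hom X Y) (β : KHom Y Y) →
             (f ♯) · α ≤ β · (f ♯) → (f ♯) · (α *) ≤ (β *) · (f ♯)
    sat-5≥ : ∀ {X Y} (α : KHom X X) (f : Hom X Y) (β : KHom Y Y) →
             β · (f ♯) ≤ (f ♯) · α → (β *) · (f ♯) ≤ (f ♯) · (α *)

module Submission where

open import Defs
open import Level using (Level)
open import Data.Product using (Σ-syntax; _,_; proj₁; proj₂)
open import Data.Nat using (zero; suc; _+_)
open import Relation.Binary.PropositionalEquality
  using (_≡_; refl; sym; trans; cong; subst; subst₂; module ≡-Reasoning)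

-- α* is the least reflexive, transitive Kleisli endomorphism above α: the
-- powers of 1 ∨ α ascend, their supremum is idempotent because composition
-- preserves suprema in each argument, and any such β bounds every power.
-- An inequation f♯ · α ≤ β · f♯ passes to 1 ∨ α by join compatibility,
-- then to all powers by induction, then to the suprema.

module KleisliLaws {o h : Level} {C : Category o h} (M : Monad C) where
  open Category C
  open Monad M
  open Kleisli M
  open ≡-Reasoning

  ·-identityˡ : ∀ {X Y} (f : KHom X Y) → kid · f ≡ f
  ·-identityˡ {Y = Y} f = begin
    μ Y ∘ (T₁ (η Y) ∘ f)  ≡⟨ sym (assoc _ _ _) ⟩
    (μ Y ∘ T₁ (η Y)) ∘ f  ≡⟨ cong (_∘ f) (μ-unitʳ Y) ⟩
    id ∘ f                ≡⟨ identityˡ f ⟩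
    f                     ∎

  ·-identityʳ : ∀ {X Y} (f : KHom X Y) → f · kid ≡ f
  ·-identityʳ {X} {Y} f = begin
    μ Y ∘ (T₁ f ∘ η X)      ≡⟨ cong (μ Y ∘_) (η-natural f) ⟩
    μ Y ∘ (η (T₀ Y) ∘ f)    ≡⟨ sym (assoc _ _ _) ⟩
    (μ Y ∘ η (T₀ Y)) ∘ f    ≡⟨ cong (_∘ f) (μ-unitˡ Y) ⟩
    id ∘ f                  ≡⟨ identityˡ f ⟩
    f                       ∎

  ·-assoc : ∀ {W X Y Z} (k : KHom Y Z) (g : KHom X Y) (f : KHom W X) →
            (k · g) · f ≡ k · (g · f)
  ·-assoc {Y = Y} {Z} k g f = begin
    μ Z ∘ (T₁ (μ Z ∘ (T₁ k ∘ g)) ∘ f)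
      ≡⟨ cong (λ x → μ Z ∘ (x ∘ f)) (trans (T-∘ _ _) (cong (T₁ (μ Z) ∘_) (T-∘ _ _))) ⟩
    μ Z ∘ ((T₁ (μ Z) ∘ (T₁ (T₁ k) ∘ T₁ g)) ∘ f)
      ≡⟨ trans (cong (μ Z ∘_) (assoc _ _ _)) (sym (assoc _ _ _)) ⟩
    (μ Z ∘ T₁ (μ Z)) ∘ ((T₁ (T₁ k) ∘ T₁ g) ∘ f)
      ≡⟨ cong (_∘ ((T₁ (T₁ k) ∘ T₁ g) ∘ f)) (μ-assoc Z) ⟩
    (μ Z ∘ μ (T₀ Z)) ∘ ((T₁ (T₁ k) ∘ T₁ g) ∘ f)
      ≡⟨ trans (assoc _ _ _) (cong (λ x → μ Z ∘ (μ (T₀ Z) ∘ x)) (assoc _ _ _)) ⟩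
    μ Z ∘ (μ (T₀ Z) ∘ (T₁ (T₁ k) ∘ (T₁ g ∘ f)))
      ≡⟨ cong (μ Z ∘_) (sym (assoc _ _ _)) ⟩
    μ Z ∘ ((μ (T₀ Z) ∘ T₁ (T₁ k)) ∘ (T₁ g ∘ f))
      ≡⟨ cong (λ x → μ Z ∘ (x ∘ (T₁ g ∘ f))) (sym (μ-natural k)) ⟩
    μ Z ∘ ((T₁ k ∘ μ Y) ∘ (T₁ g ∘ f))
      ≡⟨ cong (μ Z ∘_) (assoc _ _ _) ⟩
    μ Z ∘ (T₁ k ∘ (μ Y ∘ (T₁ g ∘ f)))
      ∎

  ^-+ : ∀ {X} (γ : KHom X X) m n → (γ ^ m) · (γ ^ n) ≡ γ ^ (m + n)
  ^-+ γ zero    n = ·-identityˡ _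
  ^-+ γ (suc m) n = trans (·-assoc _ _ _) (cong (γ ·_) (^-+ γ m n))

module KleisliOrderLaws {o h ℓ : Level} {C : Category o h} {M : Monad C}
                        (O : KlOrder M ℓ) where
  open Kleisli M
  open KlOrder O
  open KleisliLaws M

  ≡⇒≤ : ∀ {X Y} {f g : KHom X Y} → f ≡ g → f ≤ g
  ≡⇒≤ refl = ≤-refl

  ^-ascending : ∀ {X} {γ : KHom X X} → kid ≤ γ → Ascending (γ ^_)
  ^-ascending {γ = γ} 1≤γ n =
    subst (_≤ γ · γ ^ n) (·-identityˡ _) (·-mono ≤-refl 1≤γ)

  ^-least : ∀ {X} {γ β : KHom X X} → kid ≤ β → γ ≤ β → β · β ≤ β →
            ∀ n → γ ^ n ≤ β
  ^-least 1≤β γ≤β ββ≤β zero    = 1≤β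
  ^-least 1≤β γ≤β ββ≤β (suc n) =
    ≤-trans (·-mono (^-least 1≤β γ≤β ββ≤β n) γ≤β) ββ≤β

  ^-intertwine≤ : ∀ {X Y} {a : KHom X X} {b : KHom Y Y} {f : KHom X Y} →
                  f · a ≤ b · f → ∀ n → f · a ^ n ≤ b ^ n · f
  ^-intertwine≤ {f = f} fa≤bf zero =
    ≡⇒≤ (trans (·-identityʳ f) (sym (·-identityˡ f)))
  ^-intertwine≤ {a = a} {b} {f} fa≤bf (suc n) =
    ≤-trans (≡⇒≤ (sym (·-assoc f a (a ^ n))))
    (≤-trans (·-mono ≤-refl fa≤bf)
    (≤-trans (≡⇒≤ (·-assoc b f (a ^ n)))
    (≤-trans (·-mono (^-intertwine≤ fa≤bf n) ≤-refl)
    (≡⇒≤ (sym (·-assoc b (b ^ n) f))))))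

  ^-intertwine≥ : ∀ {X Y} {a : KHom X X} {b : KHom Y Y} {f : KHom X Y} →
                  b · f ≤ f · a → ∀ n → b ^ n · f ≤ f · a ^ n
  ^-intertwine≥ {f = f} bf≤fa zero =
    ≡⇒≤ (trans (·-identityˡ f) (sym (·-identityʳ f)))
  ^-intertwine≥ {a = a} {b} {f} bf≤fa (suc n) =
    ≤-trans (≡⇒≤ (·-assoc b (b ^ n) f))
    (≤-trans (·-mono (^-intertwine≥ bf≤fa n) ≤-refl)
    (≤-trans (≡⇒≤ (sym (·-assoc b f (a ^ n))))
    (≤-trans (·-mono ≤-refl bf≤fa)
    (≡⇒≤ (·-assoc f a (a ^ n))))))

module SupremumOfPowers {o h ℓ : Level} {C : Category o h} {M : Monad C}
                        {O : KlOrder M ℓ} (W : OmegaCpoEnriched O) where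
  open Kleisli M
  open KlOrder O
  open OmegaCpoEnriched W
  open KleisliLaws M
  open KleisliOrderLaws O

  ⋁^ : ∀ {X} (γ : KHom X X) → kid ≤ γ → KHom X X
  ⋁^ γ 1≤γ = sup (γ ^_) (^-ascending 1≤γ)

  ⋁^-isSup : ∀ {X} (γ : KHom X X) (1≤γ : kid ≤ γ) → IsSup (γ ^_) (⋁^ γ 1≤γ)
  ⋁^-isSup γ 1≤γ = sup-isSup (γ ^_) (^-ascending 1≤γ)

  ⋁^-upper : ∀ {X} {γ : KHom X X} (1≤γ : kid ≤ γ) n → γ ^ n ≤ ⋁^ γ 1≤γ
  ⋁^-upper 1≤γ = proj₁ (⋁^-isSup _ 1≤γ)

  ⋁^-least : ∀ {X} {γ : KHom X X} (1≤γ : kid ≤ γ) {u : KHom X X} →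
             (∀ n → γ ^ n ≤ u) → ⋁^ γ 1≤γ ≤ u
  ⋁^-least 1≤γ {u} = proj₂ (⋁^-isSup _ 1≤γ) u

  ⋁^-idempotent : ∀ {X} {γ : KHom X X} (1≤γ : kid ≤ γ) →
                  ⋁^ γ 1≤γ · ⋁^ γ 1≤γ ≤ ⋁^ γ 1≤γ
  ⋁^-idempotent {γ = γ} 1≤γ =
    proj₂ (·-sup-left (γ ^_) (^-ascending 1≤γ) s) s λ m →
      proj₂ (·-sup-right (γ ^ m) (γ ^_) (^-ascending 1≤γ)) s λ n →
        ≤-trans (≡⇒≤ (^-+ γ m n)) (⋁^-upper 1≤γ (m + n))
    where s = ⋁^ γ 1≤γ

  ⋁^-intertwine≤ : ∀ {X Y} {a : KHom X X} {b : KHom Y Y} {f : KHom X Y}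
                   (1≤a : kid ≤ a) (1≤b : kid ≤ b) →
                   f · a ≤ b · f → f · ⋁^ a 1≤a ≤ ⋁^ b 1≤b · f
  ⋁^-intertwine≤ {a = a} {b} {f} 1≤a 1≤b fa≤bf =
    proj₂ (·-sup-right f (a ^_) (^-ascending 1≤a)) (⋁^ b 1≤b · f) λ n →
      ≤-trans (^-intertwine≤ fa≤bf n) (·-mono ≤-refl (⋁^-upper 1≤b n))

  ⋁^-intertwine≥ : ∀ {X Y} {a : KHom X X} {b : KHom Y Y} {f : KHom X Y}
                   (1≤a : kid ≤ a) (1≤b : kid ≤ b) →
                   b · f ≤ f · a → ⋁^ b 1≤b · f ≤ f · ⋁^ a 1≤a
  ⋁^-intertwine≥ {a = a} {b} {f} 1≤a 1≤b bf≤fa =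
    proj₂ (·-sup-left (b ^_) (^-ascending 1≤b) f) (f · ⋁^ a 1≤a) λ n →
      ≤-trans (^-intertwine≥ bf≤fa n) (·-mono (⋁^-upper 1≤a n) ≤-refl)

module Saturation {o h ℓ : Level} {C : Category o h} {M : Monad C}
                  {O : KlOrder M ℓ} (W : OmegaCpoEnriched O)
                  (J : FiniteJoins O) (JC : JoinCompatible O J) where
  open Category C using (Hom)
  open Kleisli M
  open KlOrder O
  open FiniteJoins J
  open KleisliLaws M
  open KleisliOrderLaws O
  open SupremumOfPowers W

  ∨-comm : ∀ {X Y} (f g : KHom X Y) → f ∨ g ≡ g ∨ f
  ∨-comm f g = ≤-antisym (∨-least (∨-upperʳ g f) (∨-upperˡ g f))
                         (∨-least (∨-upperʳ f g) (∨-upperˡ f g))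

  star : ∀ {X} → KHom X X → KHom X X
  star α = ⋁^ (kid ∨ α) (∨-upperˡ kid α)

  star-reflexive : ∀ {X} (α : KHom X X) → kid ≤ star α
  star-reflexive α = ⋁^-upper (∨-upperˡ kid α) 0

  star-extensive : ∀ {X} (α : KHom X X) → α ≤ star α
  star-extensive α =
    ≤-trans (∨-upperʳ kid α)
      (subst (_≤ star α) (·-identityʳ (kid ∨ α)) (⋁^-upper (∨-upperˡ kid α) 1))

  star-least : ∀ {X} (α β : KHom X X) → kid ≤ β → α ≤ β → β · β ≤ β → star α ≤ β
  star-least α β 1≤β α≤β ββ≤β =
    ⋁^-least (∨-upperˡ kid α) (^-least 1≤β (∨-least 1≤β α≤β) ββ≤β)

  ♯-join-compatible≤ : ∀ {X Y} (α : KHom X X) (f : Hom X Y) (β : KHom Y Y) →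
                       (f ♯) · α ≤ β · (f ♯) → (f ♯) · (kid ∨ α) ≤ (kid ∨ β) · (f ♯)
  ♯-join-compatible≤ α f β fα≤βf =
    subst₂ (λ a b → (f ♯) · a ≤ b · (f ♯)) (∨-comm α kid) (∨-comm β kid)
      (proj₁ (JC α f β) fα≤βf)

  ♯-join-compatible≥ : ∀ {X Y} (α : KHom X X) (f : Hom X Y) (β : KHom Y Y) →
                       β · (f ♯) ≤ (f ♯) · α → (kid ∨ β) · (f ♯) ≤ (f ♯) · (kid ∨ α)
  ♯-join-compatible≥ α f β βf≤fα =
    subst₂ (λ a b → b · (f ♯) ≤ (f ♯) · a) (∨-comm α kid) (∨-comm β kid)
      (proj₂ (JC α f β) βf≤fα)

  orderedSaturation : OrderedSaturation O
  orderedSaturation = record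
    { _*     = star
    ; sat-1  = star-reflexive
    ; sat-2  = star-extensive
    ; sat-3  = λ α → ⋁^-idempotent (∨-upperˡ kid α)
    ; sat-4  = star-least
    ; sat-5≤ = λ α f β p → ⋁^-intertwine≤ (∨-upperˡ kid α) (∨-upperˡ kid β)
                                          (♯-join-compatible≤ α f β p)
    ; sat-5≥ = λ α f β p → ⋁^-intertwine≥ (∨-upperˡ kid α) (∨-upperˡ kid β)
                                          (♯-join-compatible≥ α f β p)
    }

theorem5p7 : {o h ℓ : Level} (C : Category o h) (M : Monad C) (O : KlOrder M ℓ) →
    OmegaCpoEnriched O → (J : FiniteJoins O) → JoinCompatible O J →
    Σ[ S ∈ OrderedSaturation O ]
    (∀ {X} (α : Kleisli.KHom M X X) →
    KlOrder.IsSup O (λ n → Kleisli._^_ M (FiniteJoins._∨_ J (Kleisli.kid M) α) n)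
    (OrderedSaturation._* S α))
theorem5p7 C M O W J JC =
  orderedSaturation , λ α → ⋁^-isSup (kid ∨ α) (∨-upperˡ kid α)
  where
  open Kleisli M using (kid)
  open FiniteJoins J using (_∨_; ∨-upperˡ)
  open SupremumOfPowers W using (⋁^-isSup)
  open Saturation W J JC using (orderedSaturation)
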